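{- There exists a structure of cardinality $2$ that is a model of $(\Sigma^\sharp \setminus \{B8\}) \cup \{\neg B8\}$, where $\Sigma^\sharp$ is the axiom system described in the context.
   Context: Work in classical one-sorted first-order logic with equality, in the language with three constant symbols $a_0, a_1, a_2$, a ternary relation symbol $L$ (collinearity) and a ternary function symbol $\tau$. Write $\sigma(a,b)$ as an abbreviation for $\tau(b,a,a)$. The axioms below are understood as universally closed: A3: $a \ne b \wedge L(a,b,c) \wedge L(a,b,d) \rightarrow L(a,c,d)$; B1: $L(a,b,c) \rightarrow L(b,a,c)$; B2: $\tau(a,b,c) = \tau(a,c,b)$; B3: $L(a,b,\sigma(a,b))$; B4: $L(a,b,c) \rightarrow L(x, \tau(a,b,x), \tau(a,c,x))$; B6: $\tau(a,b,x) = \tau(c, \tau(a,b,x), x)$; B7: $\neg L(a_0,a_1,a_2)$; B8: $\sigma(a,b) = b \rightarrow a = b$. $\Sigma^\sharp$ is the set $\{A3,B1,B2,B3,B4,B6,B7,B8\}$. -}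

module Defs where

open import Data.Product using (_×_)
open import Relation.Binary.PropositionalEquality using (_≡_)
open import Relation.Nullary using (¬_)

record Structure : Set₁ where
  field
    Carrier : Set
    a₀ a₁ a₂ : Carrier
    L : Carrier → Carrier → Carrier → Set
    τ : Carrier → Carrier → Carrier → Carrier

  σ : Carrier → Carrier → Carrier
  σ a b = τ b a a

module _ (M : Structure) where
  open Structure M

  A3 : Set
  A3 = ∀ a b c d → ¬ (a ≡ b) → L a b c → L a b d → L a c d

  B1 : Set
  B1 = ∀ a b c → L a b c → L b a c

  B2 : Set
  B2 = ∀ a b c → τ a b c ≡ τ a c b

  B3 : Set
  B3 = ∀ a b → L a b (σ a b)

  B4 : Set
  B4 = ∀ a b c x → L a b c → L x (τ a b x) (τ a c x)

  B6 : Set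
  B6 = ∀ a b c x → τ a b x ≡ τ c (τ a b x) x

  B7 : Set
  B7 = ¬ L a₀ a₁ a₂

  B8 : Set
  B8 = ∀ a b → σ a b ≡ b → a ≡ b

  ModelOfΣ♯MinusB8PlusNotB8 : Set
  ModelOfΣ♯MinusB8PlusNotB8 = A3 × B1 × B2 × B3 × B4 × B6 × B7 × ¬ B8

-- Collapse τ to a constant point o and call a triple collinear when its last
-- entry is o or all three entries coincide.  Then σ(a,b) = o always, so B3,
-- B4 and B6 hold trivially, A3 holds because two distinct points only see o
-- on their line, B7 holds for a₀ = o and a₁ = a₂ = p ≠ o, and B8 fails at
-- σ(p,o) = o.
module Submission where

open import Defs
open import Data.Bool using (Bool; true; false)
open import Data.Fin using (Fin)
open import Data.Fin.Properties using (2↔Bool)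
open import Data.Product using (Σ-syntax; _×_; _,_)
open import Data.Sum using (_⊎_; inj₁; inj₂)
open import Function.Bundles using (_↔_)
open import Function.Properties.Inverse using (↔-sym)
open import Relation.Binary.PropositionalEquality using (_≡_; refl; sym; trans)
open import Relation.Nullary using (¬_; contradiction)

module PointedModel {A : Set} (o p : A) (p≢o : ¬ p ≡ o) where

  L : A → A → A → Set
  L a b c = c ≡ o ⊎ (a ≡ b × b ≡ c)

  structure : Structure
  structure = record
    { Carrier = A ; a₀ = o ; a₁ = p ; a₂ = p
    ; L = L ; τ = λ _ _ _ → o }

  a3 : A3 structure
  a3 a b c d a≢b _ (inj₁ d≡o)       = inj₁ d≡o
  a3 a b c d a≢b _ (inj₂ (a≡b , _)) = contradiction a≡b a≢b

  b1 : B1 structure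
  b1 a b c (inj₁ c≡o)           = inj₁ c≡o
  b1 a b c (inj₂ (a≡b , b≡c)) = inj₂ (sym a≡b , trans a≡b b≡c)

  b7 : B7 structure
  b7 (inj₁ p≡o)       = p≢o p≡o
  b7 (inj₂ (o≡p , _)) = p≢o (sym o≡p)

  ¬b8 : ¬ B8 structure
  ¬b8 b8 = p≢o (b8 p o refl)

  isModel : ModelOfΣ♯MinusB8PlusNotB8 structure
  isModel =
    a3 , b1 , (λ _ _ _ → refl) , (λ _ _ → inj₁ refl) , (λ _ _ _ _ _ → inj₁ refl)
       , (λ _ _ _ _ → refl) , b7 , ¬b8

proposition9 : Σ[ M ∈ Structure ] ((Structure.Carrier M ↔ Fin 2) × ModelOfΣ♯MinusB8PlusNotB8 M)
proposition9 = structure , ↔-sym 2↔Bool , isModel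
  where open PointedModel false true (λ ())
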